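{- A positive integer $n$ belongs to none of the families $p^k$, $pq^k$, $2pq^k$, $pqr$, $2pqr$ (where $p,q,r$ are pairwise distinct primes and $k\ge0$ an integer) if and only if $n=n_1n_2$ for some coprime positive integers $n_1,n_2$ with $\Omega^*(n_1)\ge 2$ and $\Omega^*(n_2)\ge 2$.
   Context: For a positive integer $m$, $\Omega(m)$ denotes the total number of prime factors of $m$ counted with multiplicity, and $\Omega^*(m)=\Omega(m)$ if $m$ is odd, $\Omega^*(m)=\Omega(m/2)$ if $m$ is even. -}

module Defs where

open import Data.Nat using (ℕ; zero; suc; _*_; _^_; _/_)
open import Data.Nat.Divisibility using (_∣?_)
open import Data.Nat.Primality using (Prime)
open import Data.Nat.Primality.Factorisation using (factorise; factors)
open import Data.List using (length)
open import Data.Product using (∃-syntax; _×_)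
open import Data.Sum using (_⊎_)
open import Relation.Binary.PropositionalEquality using (_≡_; _≢_)
open import Relation.Nullary using (yes; no)

-- Ω(m): number of prime factors of m counted with multiplicity,
-- computed as the length of the stdlib prime factorisation of m.
-- (Ω 0 = 0 is an irrelevant convention; only positive m matter.)
Ω : ℕ → ℕ
Ω zero    = 0
Ω (suc m) = length (factors (factorise (suc m)))

Ω* : ℕ → ℕ
Ω* m with 2 ∣? m
... | yes _ = Ω (m / 2)
... | no  _ = Ω m

InFamilies : ℕ → Set
InFamilies n =
    (∃[ p ] ∃[ k ] Prime p × n ≡ p ^ k)
  ⊎ (∃[ p ] ∃[ q ] ∃[ k ] Prime p × Prime q × p ≢ q × n ≡ p * q ^ k)
  ⊎ (∃[ p ] ∃[ q ] ∃[ k ] Prime p × Prime q × p ≢ q × n ≡ 2 * p * q ^ k)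
  ⊎ (∃[ p ] ∃[ q ] ∃[ r ] Prime p × Prime q × Prime r × p ≢ q × p ≢ r × q ≢ r
        × n ≡ p * q * r)
  ⊎ (∃[ p ] ∃[ q ] ∃[ r ] Prime p × Prime q × Prime r × p ≢ q × p ≢ r × q ≢ r
        × n ≡ 2 * p * q * r)

-- Ω* is additive on coprime factors and monotone under divisibility, and Ω* m ≤ 1 exactly
-- when m is 1, p or 2p.  A coprime split therefore forces Ω* n ≥ 4, which excludes pqr and
-- 2pqr; and if n = c q^k with c ∈ {1, p, 2p}, the part of a split that is prime to q divides
-- c, so its Ω* is at most 1.  Conversely write n = 2^a m with m odd.  If some odd prime q has
-- q² ∣ n, split off the full power q^e (Ω* = e ≥ 2); otherwise m is squarefree and, once it
-- has two prime factors p, q, split off pq (Ω* = 2).  Either the cofactor has Ω* ≥ 2 and we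
-- have the split, or it is 1, p or 2p, which places n in one of the five families.

module Submission where

open import Defs
open import Data.Nat hiding (parity)
open import Data.Nat.Properties
open import Data.Nat.Divisibility
open import Data.Nat.DivMod using (m*n/n≡m)
open import Data.Nat.Coprimality as Coprimality using (Coprime; coprime-divisor)
open import Data.Nat.Primality
open import Data.Nat.Primality.Factorisation
open import Data.Nat.ListAction using (product)
open import Data.Nat.ListAction.Properties using (product-++)
open import Data.Nat.Induction using (<-wellFounded)
open import Data.Nat.Tactic.RingSolver using (solve-∀)
open import Induction.WellFounded using (Acc; acc)
open import Data.List using ([]; _∷_; _++_; length)
open import Data.List.Properties using (length-++)
open import Data.List.Relation.Unary.All as All using (All; []; _∷_)
open import Data.List.Relation.Unary.All.Properties using (++⁺)
open import Data.List.Relation.Unary.Any as Any using (any?)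
open import Data.List.Relation.Binary.Permutation.Propositional.Properties using (↭-length)
open import Data.Product using (∃-syntax; _×_; _,_)
open import Data.Sum using (_⊎_; inj₁; inj₂; [_,_]′)
open import Function using (id)
open import Function.Bundles using (_⇔_; mk⇔)
open import Relation.Binary.PropositionalEquality
open import Relation.Nullary using (¬_; yes; no; contradiction)

private variable
  c d e k m n p q r : ℕ

*-pos : 0 < m → 0 < n → 0 < m * n
*-pos {suc _} {suc _} _ _ = z<s

*-pos⁻ʳ : ∀ m n → 0 < m * n → 0 < n
*-pos⁻ʳ m zero    m*0>0 = contradiction (subst (0 <_) (*-zeroʳ m) m*0>0) (<-irrefl refl)
*-pos⁻ʳ m (suc _) _     = z<s

*-pos⁻ˡ : ∀ m n → 0 < m * n → 0 < m
*-pos⁻ˡ m n m*n>0 = *-pos⁻ʳ n m (subst (0 <_) (*-comm m n) m*n>0)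

prime>0 : Prime p → 0 < p
prime>0 {p} pp = >-nonZero⁻¹ p {{prime⇒nonZero pp}}

^-pos : 0 < p → ∀ k → 0 < p ^ k
^-pos {p} p>0 k = m^n>0 p {{>-nonZero p>0}} k

prime∤⇒coprime : Prime p → ¬ p ∣ n → Coprime p n
prime∤⇒coprime pp p∤n (d∣p , d∣n) with prime⇒irreducible pp d∣p
... | inj₁ d≡1 = d≡1
... | inj₂ refl = contradiction d∣n p∤n

coprime∧∣⇒∤ : Coprime m n → Prime p → p ∣ m → ¬ p ∣ n
coprime∧∣⇒∤ m⊥n pp p∣m p∣n = ¬prime[1] (subst Prime (m⊥n (p∣m , p∣n)) pp)

coprime-∣ʳ : Coprime m n → d ∣ n → Coprime m d
coprime-∣ʳ m⊥n d∣n (e∣m , e∣d) = m⊥n (e∣m , ∣-trans e∣d d∣n)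

coprime-*ʳ : Coprime m n → Coprime m k → Coprime m (n * k)
coprime-*ʳ {m} {n} m⊥n m⊥k {d} (d∣m , d∣nk) = m⊥k (d∣m , coprime-divisor d⊥n d∣nk)
  where
  d⊥n : Coprime d n
  d⊥n (e∣d , e∣n) = m⊥n (∣-trans e∣d d∣m , e∣n)

coprime-^ʳ : Coprime m n → ∀ k → Coprime m (n ^ k)
coprime-^ʳ m⊥n zero    (_ , d∣1) = ∣1⇒≡1 d∣1
coprime-^ʳ m⊥n (suc k) = coprime-*ʳ m⊥n (coprime-^ʳ m⊥n k)

prime∤-* : Prime p → ¬ p ∣ m → ¬ p ∣ n → ¬ p ∣ m * n
prime∤-* {m = m} {n} pp p∤m p∤n p∣mn = [ p∤m , p∤n ]′ (euclidsLemma m n pp p∣mn)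

prime∤-^ : Prime p → ¬ p ∣ m → ∀ k → ¬ p ∣ m ^ k
prime∤-^ pp p∤m k = coprime∧∣⇒∤ (coprime-^ʳ (prime∤⇒coprime pp p∤m) k) pp ∣-refl

Squarefree : ℕ → Set
Squarefree m = ∀ {p} → Prime p → ¬ p * p ∣ m

squarefree-∣ : d ∣ m → Squarefree m → Squarefree d
squarefree-∣ d∣m sf pp p²∣d = sf pp (∣-trans p²∣d d∣m)

squarefree⇒coprime : Prime p → Squarefree (p * m) → Coprime p m
squarefree⇒coprime {p} pp sf = prime∤⇒coprime pp (λ p∣m → sf pp (*-monoʳ-∣ p p∣m))

split-prime-power : Prime q → 0 < n → ∃[ e ] ∃[ r ] n ≡ q ^ e * r × ¬ q ∣ r
split-prime-power {q} pq n>0 = go n>0 (<-wellFounded _)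
  where
  go : 0 < n → Acc _<_ n → ∃[ e ] ∃[ r ] n ≡ q ^ e * r × ¬ q ∣ r
  go {n} n>0 (acc smaller) with q ∣? n
  ... | no q∤n = 0 , n , sym (*-identityˡ n) , q∤n
  ... | yes (divides k refl) with go k>0 (smaller k<k*q)
    where
    k>0 = *-pos⁻ˡ k q n>0
    k<k*q = m<m*n k q {{>-nonZero k>0}} (nonTrivial⇒n>1 q {{prime⇒nonTrivial pq}})
  ...   | e , r , refl , q∤r = suc e , r , trans (*-comm _ q) (sym (*-assoc q (q ^ e) r)) , q∤r

2≤multiplicity : Prime q → ¬ q ∣ r → q * q ∣ q ^ e * r → 2 ≤ e
2≤multiplicity {q} {r} {zero} _ q∤r q²∣ =
  contradiction (∣-trans (m∣m*n q) (subst (q * q ∣_) (*-identityˡ r) q²∣)) q∤r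
2≤multiplicity {q} {r} {suc zero} pq q∤r q²∣ =
  contradiction (*-cancelˡ-∣ q {{prime⇒nonZero pq}} q²∣qr) q∤r
  where q²∣qr = subst (q * q ∣_) (cong (_* r) (*-identityʳ q)) q²∣
2≤multiplicity {e = suc (suc _)} _ _ _ = s≤s (s≤s z≤n)

factorisation : 0 < m → ∃[ ps ] All Prime ps × m ≡ product ps
factorisation {suc m} _ =
  factors f , PrimeFactorisation.factorsPrime f , PrimeFactorisation.isFactorisation f
  where f = factorise (suc m)

Ω-product : ∀ {ps} → All Prime ps → Ω (product ps) ≡ length ps
Ω-product {ps} prime-ps with product ps in eq | productOfPrimes≥1 prime-ps
... | suc m | _ = ↭-length (factorisationUnique (factorise (suc m)) record
  { factors = ps ; isFactorisation = sym eq ; factorsPrime = prime-ps })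

Ω-* : 0 < m → 0 < n → Ω (m * n) ≡ Ω m + Ω n
Ω-* m>0 n>0 with factorisation m>0 | factorisation n>0
... | ps , prime-ps , refl | qs , prime-qs , refl = begin
  Ω (product ps * product qs)     ≡⟨ cong Ω (product-++ ps qs) ⟨
  Ω (product (ps ++ qs))          ≡⟨ Ω-product (++⁺ prime-ps prime-qs) ⟩
  length (ps ++ qs)               ≡⟨ length-++ ps ⟩
  length ps + length qs           ≡⟨ cong₂ _+_ (Ω-product prime-ps) (Ω-product prime-qs) ⟨
  Ω (product ps) + Ω (product qs) ∎
  where open ≡-Reasoning

Ω-prime : Prime p → Ω p ≡ 1
Ω-prime {p} pp = subst (λ x → Ω x ≡ 1) (*-identityʳ p) (Ω-product (pp ∷ []))

Ω-*prime : 0 < m → Prime p → Ω (m * p) ≡ suc (Ω m)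
Ω-*prime {m} m>0 pp = trans (Ω-* m>0 (prime>0 pp)) (trans (cong (Ω m +_) (Ω-prime pp)) (+-comm (Ω m) 1))

Ω-^ : Prime p → ∀ k → Ω (p ^ k) ≡ k
Ω-^ pp zero    = refl
Ω-^ pp (suc k) = trans (Ω-* (prime>0 pp) (^-pos (prime>0 pp) k)) (cong₂ _+_ (Ω-prime pp) (Ω-^ pp k))

Ω-mono : 0 < n → m ∣ n → Ω m ≤ Ω n
Ω-mono {m = m} n>0 (divides k refl) =
  ≤-trans (m≤n+m (Ω m) (Ω k)) (≤-reflexive (sym (Ω-* (*-pos⁻ˡ k m n>0) (*-pos⁻ʳ k m n>0))))

Ω≤1⇒1⊎prime : 0 < m → Ω m ≤ 1 → m ≡ 1 ⊎ Prime m
Ω≤1⇒1⊎prime m>0 Ωm≤1 with factorisation m>0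
... | [] , _ , refl = inj₁ refl
... | p ∷ [] , pp ∷ [] , refl = inj₂ (subst Prime (sym (*-identityʳ p)) pp)
... | _ ∷ _ ∷ _ , prime-ps , refl with subst (_≤ 1) (Ω-product prime-ps) Ωm≤1
...   | s≤s ()

data Parity : ℕ → Set where
  odd  : ¬ 2 ∣ m → Parity m
  even : ∀ m → Parity (2 * m)

parity : ∀ m → Parity m
parity m with 2 ∣? m
... | no 2∤m = odd 2∤m
... | yes (divides k refl) = subst Parity (*-comm 2 k) (even k)

Ω*-odd : ¬ 2 ∣ m → Ω* m ≡ Ω m
Ω*-odd {m} 2∤m with 2 ∣? m
... | yes 2∣m = contradiction 2∣m 2∤m
... | no _ = refl

Ω*-2* : ∀ m → Ω* (2 * m) ≡ Ω m
Ω*-2* m with 2 ∣? 2 * m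
... | yes _ = cong Ω (trans (cong (_/ 2) (*-comm 2 m)) (m*n/n≡m m 2))
... | no 2∤2m = contradiction (m∣m*n m) 2∤2m

Ω*≤Ω : 0 < m → Ω* m ≤ Ω m
Ω*≤Ω {m} m>0 with parity m
... | odd 2∤m = ≤-reflexive (Ω*-odd 2∤m)
... | even k = subst (_≤ Ω (2 * k)) (sym (Ω*-2* k)) (Ω-mono m>0 (n∣m*n 2 {k}))

Ω*-mono : 0 < n → m ∣ n → Ω* m ≤ Ω* n
Ω*-mono {n} {m} n>0 m∣n with parity m | parity n
... | odd 2∤m | odd 2∤n = begin
  Ω* m ≡⟨ Ω*-odd 2∤m ⟩
  Ω m  ≤⟨ Ω-mono n>0 m∣n ⟩
  Ω n  ≡⟨ Ω*-odd 2∤n ⟨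
  Ω* n ∎
  where open ≤-Reasoning
... | odd 2∤m | even k = begin
  Ω* m         ≡⟨ Ω*-odd 2∤m ⟩
  Ω m          ≤⟨ Ω-mono (*-pos⁻ʳ 2 k n>0) (coprime-divisor {o = k} m⊥2 m∣n) ⟩
  Ω k          ≡⟨ Ω*-2* k ⟨
  Ω* (2 * k)   ∎
  where open ≤-Reasoning
        m⊥2 = Coprimality.sym (prime∤⇒coprime prime[2] 2∤m)
... | even j | odd 2∤n = contradiction (∣-trans (m∣m*n j) m∣n) 2∤n
... | even j | even k = begin
  Ω* (2 * j) ≡⟨ Ω*-2* j ⟩
  Ω j        ≤⟨ Ω-mono (*-pos⁻ʳ 2 k n>0) (*-cancelˡ-∣ {j} 2 m∣n) ⟩
  Ω k        ≡⟨ Ω*-2* k ⟨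
  Ω* (2 * k) ∎
  where open ≤-Reasoning

Ω*-*-coprime : 0 < m → 0 < n → Coprime m n → Ω* (m * n) ≡ Ω* m + Ω* n
Ω*-*-coprime {m} {n} m>0 n>0 m⊥n with parity m | parity n
... | odd 2∤m | odd 2∤n = begin
  Ω* (m * n)  ≡⟨ Ω*-odd (prime∤-* prime[2] 2∤m 2∤n) ⟩
  Ω (m * n)   ≡⟨ Ω-* m>0 n>0 ⟩
  Ω m + Ω n   ≡⟨ cong₂ _+_ (Ω*-odd 2∤m) (Ω*-odd 2∤n) ⟨
  Ω* m + Ω* n ∎
  where open ≡-Reasoning
... | odd 2∤m | even k = begin
  Ω* (m * (2 * k))  ≡⟨ cong Ω* (x*[2*y]≡2*[x*y] m k) ⟩
  Ω* (2 * (m * k))  ≡⟨ Ω*-2* (m * k) ⟩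
  Ω (m * k)         ≡⟨ Ω-* m>0 (*-pos⁻ʳ 2 k n>0) ⟩
  Ω m + Ω k         ≡⟨ cong₂ _+_ (Ω*-odd 2∤m) (Ω*-2* k) ⟨
  Ω* m + Ω* (2 * k) ∎
  where open ≡-Reasoning
        x*[2*y]≡2*[x*y] : ∀ x y → x * (2 * y) ≡ 2 * (x * y)
        x*[2*y]≡2*[x*y] = solve-∀
... | even j | odd 2∤n = begin
  Ω* (2 * j * n)    ≡⟨ cong Ω* (*-assoc 2 j n) ⟩
  Ω* (2 * (j * n))  ≡⟨ Ω*-2* (j * n) ⟩
  Ω (j * n)         ≡⟨ Ω-* (*-pos⁻ʳ 2 j m>0) n>0 ⟩
  Ω j + Ω n         ≡⟨ cong₂ _+_ (Ω*-2* j) (Ω*-odd 2∤n) ⟨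
  Ω* (2 * j) + Ω* n ∎
  where open ≡-Reasoning
... | even j | even k = contradiction (m⊥n (m∣m*n {2} j , m∣m*n {2} k)) λ ()

data Ω*≤1-Form : ℕ → Set where
  one   : Ω*≤1-Form 1
  prime : Prime p → Ω*≤1-Form p
  twice : Prime p → Ω*≤1-Form (2 * p)

Ω*≤1⇒form : 0 < m → Ω* m ≤ 1 → Ω*≤1-Form m
Ω*≤1⇒form {m} m>0 Ω*m≤1 with parity m
... | odd 2∤m with Ω≤1⇒1⊎prime m>0 (subst (_≤ 1) (Ω*-odd 2∤m) Ω*m≤1)
...   | inj₁ refl = one
...   | inj₂ pm   = prime pm
Ω*≤1⇒form m>0 Ω*m≤1 | even k
  with Ω≤1⇒1⊎prime (*-pos⁻ʳ 2 k m>0) (subst (_≤ 1) (Ω*-2* k) Ω*m≤1)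
...   | inj₁ refl = prime prime[2]
...   | inj₂ pk   = twice pk

form⇒Ω*≤1 : Ω*≤1-Form m → Ω* m ≤ 1
form⇒Ω*≤1 one        = z≤n
form⇒Ω*≤1 (prime pp) = ≤-trans (Ω*≤Ω (prime>0 pp)) (≤-reflexive (Ω-prime pp))
form⇒Ω*≤1 (twice {p} pp) = ≤-reflexive (trans (Ω*-2* p) (Ω-prime pp))

form>0 : Ω*≤1-Form m → 0 < m
form>0 one        = z<s
form>0 (prime pp) = prime>0 pp
form>0 (twice pp) = *-pos {2} z<s (prime>0 pp)

CoprimeSplit : ℕ → Set
CoprimeSplit n = ∃[ n₁ ] ∃[ n₂ ] 0 < n₁ × 0 < n₂ × Coprime n₁ n₂ × n ≡ n₁ * n₂
  × Ω* n₁ ≥ 2 × Ω* n₂ ≥ 2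

pattern p^k p k pp eq = inj₁ (p , k , pp , eq)
pattern pq^k p q k pp pq p≢q eq = inj₂ (inj₁ (p , q , k , pp , pq , p≢q , eq))
pattern 2pq^k p q k pp pq p≢q eq = inj₂ (inj₂ (inj₁ (p , q , k , pp , pq , p≢q , eq)))
pattern pqr p q r pp pq pr p≢q p≢r q≢r eq =
  inj₂ (inj₂ (inj₂ (inj₁ (p , q , r , pp , pq , pr , p≢q , p≢r , q≢r , eq))))
pattern 2pqr p q r pp pq pr p≢q p≢r q≢r eq =
  inj₂ (inj₂ (inj₂ (inj₂ (p , q , r , pp , pq , pr , p≢q , p≢r , q≢r , eq))))

split⇒4≤Ω* : CoprimeSplit n → 4 ≤ Ω* n
split⇒4≤Ω* (_ , _ , n₁>0 , n₂>0 , n₁⊥n₂ , refl , big₁ , big₂) =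
  subst (4 ≤_) (sym (Ω*-*-coprime n₁>0 n₂>0 n₁⊥n₂)) (+-mono-≤ big₁ big₂)

Ω*-cofactor≤1 : Prime q → Ω*≤1-Form c → ¬ q ∣ d → d ∣ c * q ^ k → Ω* d ≤ 1
Ω*-cofactor≤1 {q} {c} {d} {k} pq form q∤d d∣cq^k =
  ≤-trans (Ω*-mono (form>0 form) (coprime-divisor d⊥q^k d∣q^kc)) (form⇒Ω*≤1 form)
  where
  d⊥q^k = coprime-^ʳ (Coprimality.sym (prime∤⇒coprime pq q∤d)) k
  d∣q^kc = subst (d ∣_) (*-comm c (q ^ k)) d∣cq^k

¬split-near-prime-power : Prime q → Ω*≤1-Form c → n ≡ c * q ^ k → ¬ CoprimeSplit n
¬split-near-prime-power {q} {k = k} pq form refl (n₁ , n₂ , _ , _ , n₁⊥n₂ , eq , big₁ , big₂)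
  with q ∣? n₂
... | no q∤n₂  = <⇒≱ big₂ (Ω*-cofactor≤1 {k = k} pq form q∤n₂ (divides n₁ eq))
... | yes q∣n₂ =
  <⇒≱ big₁ (Ω*-cofactor≤1 {k = k} pq form q∤n₁ (divides n₂ (trans eq (*-comm n₁ n₂))))
  where q∤n₁ = coprime∧∣⇒∤ (Coprimality.sym n₁⊥n₂) pq q∣n₂

Ω-three-primes : Prime p → Prime q → Prime r → Ω (p * q * r) ≡ 3
Ω-three-primes pp pq pr =
  trans (Ω-*prime (*-pos (prime>0 pp) (prime>0 pq)) pr)
        (cong suc (trans (Ω-*prime (prime>0 pp) pq) (cong suc (Ω-prime pp))))

split⇒¬InFamilies : CoprimeSplit n → ¬ InFamilies n
split⇒¬InFamilies split (p^k p k pp eq) =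
  ¬split-near-prime-power {k = k} pp one (trans eq (sym (*-identityˡ (p ^ k)))) split
split⇒¬InFamilies split (pq^k p q k pp pq _ eq) =
  ¬split-near-prime-power {k = k} pq (prime pp) eq split
split⇒¬InFamilies split (2pq^k p q k pp pq _ eq) =
  ¬split-near-prime-power {k = k} pq (twice pp) eq split
split⇒¬InFamilies split (pqr p q r pp pq pr _ _ _ refl) =
  <⇒≱ (split⇒4≤Ω* split) (≤-trans (Ω*≤Ω pqr>0) (≤-reflexive (Ω-three-primes pp pq pr)))
  where pqr>0 = *-pos (*-pos (prime>0 pp) (prime>0 pq)) (prime>0 pr)
split⇒¬InFamilies split (2pqr p q r pp pq pr _ _ _ refl) =
  <⇒≱ (split⇒4≤Ω* split) (≤-reflexive Ω*[2pqr]≡3)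
  where
  2*p*q*r≡2*[p*q*r] : ∀ p q r → 2 * p * q * r ≡ 2 * (p * q * r)
  2*p*q*r≡2*[p*q*r] = solve-∀
  Ω*[2pqr]≡3 : Ω* (2 * p * q * r) ≡ 3
  Ω*[2pqr]≡3 = trans (cong Ω* (2*p*q*r≡2*[p*q*r] p q r))
                     (trans (Ω*-2* (p * q * r)) (Ω-three-primes pp pq pr))

InFamilies⊎CoprimeSplit : ℕ → Set
InFamilies⊎CoprimeSplit n = InFamilies n ⊎ CoprimeSplit n

split⊎form : 0 < m → 0 < n → Coprime m n → 2 ≤ Ω* m → CoprimeSplit (m * n) ⊎ Ω*≤1-Form n
split⊎form {m} {n} m>0 n>0 m⊥n big with 2 ≤? Ω* n
... | yes big′ = inj₁ (m , n , m>0 , n>0 , m⊥n , refl , big , big′)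
... | no ¬big  = inj₂ (Ω*≤1⇒form n>0 (≤-pred (≰⇒> ¬big)))

prime-power-block : Prime q → 0 < r → ¬ q ∣ r → 2 ≤ Ω* (q ^ e) →
  InFamilies⊎CoprimeSplit (q ^ e * r)
prime-power-block {q} {r} {e} pq r>0 q∤r big with split⊎form (^-pos (prime>0 pq) e) r>0 q^e⊥r big
  where q^e⊥r = Coprimality.sym (coprime-^ʳ (Coprimality.sym (prime∤⇒coprime pq q∤r)) e)
... | inj₁ split      = inj₂ split
... | inj₂ one        = inj₁ (p^k q e pq (*-identityʳ (q ^ e)))
... | inj₂ (prime pr) = inj₁ (pq^k r q e pr pq (λ { refl → q∤r ∣-refl }) (*-comm (q ^ e) r))
... | inj₂ (twice {p} pp) =
  inj₁ (2pq^k p q e pp pq (λ { refl → q∤r (n∣m*n 2) }) (*-comm (q ^ e) (2 * p)))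

odd-prime-pair-block : Prime p → Prime q → p ≢ q → ¬ 2 ∣ p * q → 0 < n → Coprime (p * q) n →
  InFamilies⊎CoprimeSplit (p * q * n)
odd-prime-pair-block {p} {q} pp pq p≢q 2∤pq n>0 pq⊥n
  with split⊎form (*-pos (prime>0 pp) (prime>0 pq)) n>0 pq⊥n Ω*[pq]≥2
  where
  Ω*[pq]≥2 : 2 ≤ Ω* (p * q)
  Ω*[pq]≥2 = ≤-reflexive (sym (trans (Ω*-odd 2∤pq)
                                      (trans (Ω-*prime (prime>0 pp) pq) (cong suc (Ω-prime pp)))))
... | inj₁ split = inj₂ split
... | inj₂ one   = inj₁ (pq^k p q 1 pp pq p≢q (*-assoc p q 1))
... | inj₂ (prime {r} pr) = inj₁ (pqr p q r pp pq pr p≢q p≢r q≢r refl)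
  where
  p≢r : p ≢ r
  p≢r refl = coprime∧∣⇒∤ pq⊥n pp (m∣m*n q) ∣-refl
  q≢r : q ≢ r
  q≢r refl = coprime∧∣⇒∤ pq⊥n pq (n∣m*n p) ∣-refl
... | inj₂ (twice {r} pr) = inj₁ (2pqr p q r pp pq pr p≢q p≢r q≢r (rearrange p q r))
  where
  p≢r : p ≢ r
  p≢r refl = coprime∧∣⇒∤ pq⊥n pp (m∣m*n q) (n∣m*n 2)
  q≢r : q ≢ r
  q≢r refl = coprime∧∣⇒∤ pq⊥n pq (n∣m*n p) (n∣m*n 2)
  rearrange : ∀ p q r → p * q * (2 * r) ≡ 2 * p * q * r
  rearrange = solve-∀

Ω*-odd-prime-power : Prime q → ¬ 2 ∣ q → ∀ e → Ω* (q ^ e) ≡ e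
Ω*-odd-prime-power pq 2∤q e = trans (Ω*-odd (prime∤-^ prime[2] 2∤q e)) (Ω-^ pq e)

odd-square-block : Prime q → ¬ 2 ∣ q → 0 < n → q * q ∣ n → InFamilies⊎CoprimeSplit n
odd-square-block pq 2∤q n>0 q²∣n with split-prime-power pq n>0
... | e , r , refl , q∤r = prime-power-block {e = e} pq (*-pos⁻ʳ (_ ^ e) r n>0) q∤r
  (subst (2 ≤_) (sym (Ω*-odd-prime-power pq 2∤q e)) (2≤multiplicity pq q∤r q²∣n))

odd-squarefree-block : ∀ a {ps} → All Prime ps → ¬ 2 ∣ product ps → Squarefree (product ps) →
  InFamilies⊎CoprimeSplit (2 ^ a * product ps)
odd-squarefree-block a {[]} _ _ _ = inj₁ (p^k 2 a prime[2] (*-identityʳ (2 ^ a)))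
odd-squarefree-block a {p ∷ []} (pp ∷ []) 2∤p _ =
  inj₁ (pq^k p 2 a pp prime[2] (λ { refl → 2∤p ∣-refl })
                                (trans (cong (2 ^ a *_) (*-identityʳ p)) (*-comm (2 ^ a) p)))
odd-squarefree-block a {p ∷ q ∷ ps} (pp ∷ pq ∷ prime-ps) 2∤m sf =
  subst InFamilies⊎CoprimeSplit (sym (rearrange (2 ^ a) p q R))
    (odd-prime-pair-block pp pq p≢q 2∤pq (*-pos (^-pos z<s a) (productOfPrimes≥1 prime-ps)) pq⊥2^aR)
  where
  R = product ps
  rearrange : ∀ x p q R → x * (p * (q * R)) ≡ p * q * (x * R)
  rearrange = solve-∀
  p⊥qR : Coprime p (q * R)
  p⊥qR = squarefree⇒coprime pp sf
  q⊥R : Coprime q R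
  q⊥R = squarefree⇒coprime pq (squarefree-∣ (n∣m*n p) sf)
  p≢q : p ≢ q
  p≢q p≡q = coprime∧∣⇒∤ p⊥qR pp ∣-refl (subst (_∣ q * R) (sym p≡q) (m∣m*n R))
  2∤pq : ¬ 2 ∣ p * q
  2∤pq 2∣pq = 2∤m (∣-trans 2∣pq (*-monoʳ-∣ p (m∣m*n R)))
  pq⊥R : Coprime (p * q) R
  pq⊥R = Coprimality.sym (coprime-*ʳ (Coprimality.sym (coprime-∣ʳ p⊥qR (n∣m*n q)))
                                     (Coprimality.sym q⊥R))
  pq⊥2^aR : Coprime (p * q) (2 ^ a * R)
  pq⊥2^aR = coprime-*ʳ (coprime-^ʳ (Coprimality.sym (prime∤⇒coprime prime[2] 2∤pq)) a) pq⊥R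

family⊎split : 0 < n → InFamilies⊎CoprimeSplit n
family⊎split n>0 with split-prime-power prime[2] n>0
... | a , m , refl , 2∤m with factorisation (*-pos⁻ʳ (2 ^ a) m n>0)
...   | ps , prime-ps , refl with any? (λ q → q * q ∣? product ps) ps
...     | no no-square = odd-squarefree-block a prime-ps 2∤m squarefree
  where
  squarefree : Squarefree (product ps)
  squarefree pq q²∣m = no-square (Any.map (λ { refl → q²∣m })
    (factorisationHasAllPrimeFactors pq (∣-trans (m∣m*n _) q²∣m) prime-ps))
...     | yes has-square with All.lookupAny prime-ps has-square
...       | pq , q²∣m = odd-square-block pq 2∤q n>0 (∣n⇒∣m*n (2 ^ a) q²∣m)
  where 2∤q = λ 2∣q → 2∤m (∣-trans 2∣q (∣-trans (m∣m*n _) q²∣m))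

lemma2p2 : (n : ℕ) → 0 < n →
    (¬ InFamilies n) ⇔
    (∃[ n₁ ] ∃[ n₂ ] 0 < n₁ × 0 < n₂ × Coprime n₁ n₂ × n ≡ n₁ * n₂
      × Ω* n₁ ≥ 2 × Ω* n₂ ≥ 2)
lemma2p2 n n>0 = mk⇔
  (λ ¬family → [ (λ family → contradiction family ¬family) , id ]′ (family⊎split n>0))
  split⇒¬InFamilies
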